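{- Let $k \ge 2$ be an integer and let $D$ be a set of positive integers (a set of "differences"). For integers $x,y$ write $x * y = |x-y|$. Suppose that $D$ contains a $k$-clique, i.e. there exist integers $v_0 < v_1 < \dots < v_{k-1}$ such that $v_j - v_i \in D$ for all $0 \le i < j \le k-1$. Then there exists a set $K \subset D$ with $|K| = k-1$ such that $x * y \in D$ for all distinct $x, y \in K$.
   Context: A set of differences $D$ determines a coloring of the complete graph on vertices labelled by integers: the edge between vertices $i<j$ is "in $D$" (colored by $D$'s color) exactly when $j-i \in D$. A $k$-clique in $D$ means $k$ vertices all of whose pairwise edges are in $D$. -}

module Defs where

open import Data.Nat using (ℕ; _<_; ∣_-_∣)
open import Data.Fin using (Fin)
import Data.Fin as F
open import Data.Integer as ℤ using (ℤ)
open import Data.Product using (Σ; _×_)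

PositiveSet : (ℕ → Set) → Set
PositiveSet D = ∀ n → D n → 0 < n

_⋆_ : ℕ → ℕ → ℕ
x ⋆ y = ∣ x - y ∣

HasClique : (ℕ → Set) → ℕ → Set
HasClique D k =
  Σ (Fin k → ℤ) λ v →
    (∀ (i j : Fin k) → i F.< j → v i ℤ.< v j) ×
    (∀ (i j : Fin k) → i F.< j → D ℤ.∣ v j ℤ.- v i ∣)

-- Translate the clique so that its least vertex is 0. The other k - 1
-- vertices v₁ - v₀ < … < v_{k-1} - v₀ lie in D, and the distance between
-- two of them is a difference v_j - v_i of the original clique, hence also in D;
-- as D has no 0, distinct vertices have distinct translates.
module Submission where

open import Defs
open import Data.Nat as ℕ using (ℕ; zero; suc; _≤_; _∸_; s≤s; z<s)
import Data.Nat.Properties as ℕ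
open import Data.Fin as Fin using (Fin; zero; suc)
import Data.Fin.Properties as Fin
open import Data.Integer as ℤ using (ℤ; +_; _⊖_; _-_)
import Data.Integer.Properties as ℤ
open import Data.Integer.Solver using (module +-*-Solver)
open import Data.Product using (Σ; _×_; _,_)
open import Data.Empty using (⊥-elim)
open import Relation.Binary.PropositionalEquality
open import Relation.Binary.Definitions using (tri<; tri≈; tri>)
open import Relation.Nullary using (¬_; yes; no)
open import Function.Definitions using (Injective)

∣m⊖n∣≡∣m-n∣ : ∀ m n → ℤ.∣ m ⊖ n ∣ ≡ ℕ.∣ m - n ∣
∣m⊖n∣≡∣m-n∣ zero    zero    = refl
∣m⊖n∣≡∣m-n∣ zero    (suc n) = refl
∣m⊖n∣≡∣m-n∣ (suc m) zero    = refl
∣m⊖n∣≡∣m-n∣ (suc m) (suc n) =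
  trans (cong ℤ.∣_∣ (ℤ.[1+m]⊖[1+n]≡m⊖n m n)) (∣m⊖n∣≡∣m-n∣ m n)

[i-k]-[j-k]≡i-j : ∀ i j k → (i - k) - (j - k) ≡ i - j
[i-k]-[j-k]≡i-j = solve 3 (λ i j k → (i :- k) :- (j :- k) := i :- j) refl
  where open +-*-Solver

∣i-j∣≡∣∣i-k∣-∣j-k∣∣ : ∀ {i j k} → k ℤ.≤ i → k ℤ.≤ j →
                     ℤ.∣ i - j ∣ ≡ ℕ.∣ ℤ.∣ i - k ∣ - ℤ.∣ j - k ∣ ∣
∣i-j∣≡∣∣i-k∣-∣j-k∣∣ {i} {j} {k} k≤i k≤j = begin
  ℤ.∣ i - j ∣                           ≡⟨ cong ℤ.∣_∣ ([i-k]-[j-k]≡i-j i j k) ⟨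
  ℤ.∣ (i - k) - (j - k) ∣               ≡⟨ cong₂ (λ x y → ℤ.∣ x - y ∣) (nonneg k≤i) (nonneg k≤j) ⟨
  ℤ.∣ + ℤ.∣ i - k ∣ - + ℤ.∣ j - k ∣ ∣   ≡⟨ cong ℤ.∣_∣ (ℤ.[+m]-[+n]≡m⊖n ℤ.∣ i - k ∣ ℤ.∣ j - k ∣) ⟩
  ℤ.∣ ℤ.∣ i - k ∣ ⊖ ℤ.∣ j - k ∣ ∣       ≡⟨ ∣m⊖n∣≡∣m-n∣ ℤ.∣ i - k ∣ ℤ.∣ j - k ∣ ⟩
  ℕ.∣ ℤ.∣ i - k ∣ - ℤ.∣ j - k ∣ ∣       ∎
  where
  open ≡-Reasoning
  nonneg : ∀ {l} → k ℤ.≤ l → + ℤ.∣ l - k ∣ ≡ l - k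
  nonneg k≤l = ℤ.0≤i⇒+∣i∣≡i (ℤ.i≤j⇒0≤j-i k≤l)

⋆-comm : ∀ x y → x ⋆ y ≡ y ⋆ x
⋆-comm = ℕ.∣-∣-comm

module _ {n} (v : Fin (suc n) → ℤ) where

  distancesFromFirst : Fin n → ℕ
  distancesFromFirst i = ℤ.∣ v (suc i) - v zero ∣

  distancesFromFirst-⋆ : (∀ i → v zero ℤ.≤ v (suc i)) → ∀ i j →
    distancesFromFirst i ⋆ distancesFromFirst j ≡ ℤ.∣ v (suc i) - v (suc j) ∣
  distancesFromFirst-⋆ v₀≤ i j = sym (∣i-j∣≡∣∣i-k∣-∣j-k∣∣ (v₀≤ i) (v₀≤ j))

<-pairwise⇒≢-pairwise : ∀ {n} {R : Fin n → Fin n → Set} →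
  (∀ {i j} → R i j → R j i) → (∀ i j → i Fin.< j → R i j) →
  ∀ i j → ¬ i ≡ j → R i j
<-pairwise⇒≢-pairwise sym-R R< i j i≢j with Fin.<-cmp i j
... | tri< i<j _ _ = R< i j i<j
... | tri≈ _ i≡j _ = ⊥-elim (i≢j i≡j)
... | tri> _ _ j<i = sym-R (R< j i j<i)

⋆-pairwise⇒injective : ∀ {n D} → PositiveSet D → (K : Fin n → ℕ) →
  (∀ i j → ¬ i ≡ j → D (K i ⋆ K j)) → Injective _≡_ _≡_ K
⋆-pairwise⇒injective D⁺ K pairwise {i} {j} Ki≡Kj with i Fin.≟ j
... | yes i≡j = i≡j
... | no  i≢j = ⊥-elim (ℕ.<-irrefl refl
                  (subst (0 ℕ.<_) (ℕ.m≡n⇒∣m-n∣≡0 Ki≡Kj) (D⁺ _ (pairwise i j i≢j))))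

lemma1 : (k : ℕ) → 2 ≤ k → (D : ℕ → Set) → PositiveSet D → HasClique D k →
    Σ (Fin (k ∸ 1) → ℕ) λ K →
      Injective _≡_ _≡_ K ×
      (∀ i → D (K i)) ×
      (∀ i j → ¬ (i ≡ j) → D (K i ⋆ K j))
lemma1 (suc (suc k)) (s≤s (s≤s _)) D D⁺ (v , increasing , clique) =
  K , ⋆-pairwise⇒injective D⁺ K pairwise , K∈D , pairwise
  where
  K : Fin (suc k) → ℕ
  K = distancesFromFirst v

  K∈D : ∀ i → D (K i)
  K∈D i = clique zero (suc i) z<s

  v₀≤ : ∀ i → v zero ℤ.≤ v (suc i)
  v₀≤ i = ℤ.<⇒≤ (increasing zero (suc i) z<s)

  ordered : ∀ i j → i Fin.< j → D (K i ⋆ K j)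
  ordered i j i<j = subst D ∣vⱼ-vᵢ∣≡Kᵢ⋆Kⱼ (clique (suc i) (suc j) (s≤s i<j))
    where
    ∣vⱼ-vᵢ∣≡Kᵢ⋆Kⱼ : ℤ.∣ v (suc j) - v (suc i) ∣ ≡ K i ⋆ K j
    ∣vⱼ-vᵢ∣≡Kᵢ⋆Kⱼ = trans (ℤ.∣i-j∣≡∣j-i∣ (v (suc j)) (v (suc i)))
                         (sym (distancesFromFirst-⋆ v v₀≤ i j))

  pairwise : ∀ i j → ¬ i ≡ j → D (K i ⋆ K j)
  pairwise = <-pairwise⇒≢-pairwise (λ {i} {j} → subst D (⋆-comm (K i) (K j))) ordered
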